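{- Let $D$ be the $q$-derivative of $G_{\mathrm{AndI}}$ and let $\phi^{nc}$ be the $\mathbb{K}[q]$-algebra map sending $x_j\mapsto x$ and $y_j\mapsto y$ for all $j$, where $x,y$ are non-commuting indeterminates. Then for every $n\ge1$, the number of distinct words (in $x,y$) with nonzero coefficient in $\phi^{nc}(D^n(x_0))$ equals the Fibonacci number $F_{n+1}$.
   Context: $\mathbb{K}$ is a commutative ring with unity of characteristic zero, $q$ an indeterminate. Variables $x_i,y_i$ ($i\ge0$) form $\mathbb{S}$; $\mathbb{E}=\mathbb{K}[q][F(\mathbb{S})]$ is the group algebra of the free group on $\mathbb{S}$. $G_{\mathrm{AndI}}=(\{x,y\},R,\mathrm{AIO})$ with $R(x_j)=q^jx_jy_{j+1}$, $R(y_j)=q^jx_j$, extended by $R(s_i^{ -1})=-s_i^{ -1}R(s_i)s_{i+1}^{ -1}$; $\uparrow$ replaces every letter $s_i^{\pm1}$ by $s_{i+1}^{\pm1}$; AIO stably sorts the letters of a word by $x_0<y_0<x_1<y_1<\cdots$. Its $q$-derivative is $D(w_1\cdots w_n)=\sum_{j=1}^n\mathrm{AIO}\big(w_1\cdots w_{j-1}R(w_j)\uparrow(w_{j+1}\cdots w_n)\big)$ extended linearly. (The terms of $D^n(x_0)$ contain no inverse letters, so $\phi^{nc}$ maps them into the free associative algebra $\mathbb{K}[q]\langle x,y\rangle$.) Fibonacci numbers: $F_1=F_2=1$, $F_{m+2}=F_{m+1}+F_m$. -}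

module Defs where

open import Data.Nat using (ℕ; zero; suc; _+_; _*_; _≤ᵇ_)
open import Data.Nat.Properties using () renaming (_≟_ to _≟ℕ_)
open import Data.Bool using (Bool; true; false; if_then_else_)
open import Data.List using (List; []; _∷_; _++_; map; concatMap; length; filter)
open import Data.List.Properties using (≡-dec)
open import Data.Product using (_×_; _,_; proj₁; proj₂)
open import Relation.Nullary using (Dec; yes; no)
open import Relation.Nullary.Decidable using (_×-dec_)
open import Relation.Binary.PropositionalEquality using (_≡_; refl)

-- Letters of 𝕊 : x_i and y_i, i ≥ 0.  (Only positive letters: the terms of
-- Dⁿ(x₀) never contain inverse letters, and R maps positive letters to
-- positive words, so D restricted to positive words is the paper's D there.)
data Letter : Set where
  xₗ : ℕ → Letter
  yₗ : ℕ → Letter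

Word : Set
Word = List Letter

key : Letter → ℕ
key (xₗ i) = 2 * i
key (yₗ i) = suc (2 * i)

insertAIO : Letter → Word → Word
insertAIO a [] = a ∷ []
insertAIO a (b ∷ bs) = if key a ≤ᵇ key b then a ∷ b ∷ bs else b ∷ insertAIO a bs

AIO : Word → Word
AIO [] = []
AIO (a ∷ as) = insertAIO a (AIO as)

shiftL : Letter → Letter
shiftL (xₗ i) = xₗ (suc i)
shiftL (yₗ i) = yₗ (suc i)

↑ : Word → Word
↑ = map shiftL

-- A monomial q^e · w, represented as (e , w).  An element of 𝕂[q]⟨𝕊⟩ with
-- nonnegative integer coefficients is a finite formal sum of such monomials,
-- represented as a list (repetitions = multiplicities).
Term : Set
Term = ℕ × Word

Poly : Set
Poly = List Term

R : Letter → Term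
R (xₗ j) = j , (xₗ j ∷ yₗ (suc j) ∷ [])
R (yₗ j) = j , (xₗ j ∷ [])

Dterm-aux : ℕ → Word → Word → Poly
Dterm-aux e pre [] = []
Dterm-aux e pre (a ∷ suf) =
  (e + proj₁ (R a) , AIO (pre ++ proj₂ (R a) ++ ↑ suf))
  ∷ Dterm-aux e (pre ++ a ∷ []) suf

Dterm : Term → Poly
Dterm (e , w) = Dterm-aux e [] w

D : Poly → Poly
D = concatMap Dterm

iterate : ℕ → (Poly → Poly) → Poly → Poly
iterate zero f p = p
iterate (suc n) f p = f (iterate n f p)

x₀ : Poly
x₀ = (0 , xₗ 0 ∷ []) ∷ []

data XY : Set where
  x y : XY

_≟XY_ : (a b : XY) → Dec (a ≡ b)
x ≟XY x = yes refl
x ≟XY y = no (λ ())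
y ≟XY x = no (λ ())
y ≟XY y = yes refl

φletter : Letter → XY
φletter (xₗ _) = x
φletter (yₗ _) = y

φterm : Term → ℕ × List XY
φterm (e , w) = e , map φletter w

coeff : Poly → List XY → ℕ → ℕ
coeff p u k =
  length (filter (λ t → (proj₁ (φterm t) ≟ℕ k) ×-dec ≡-dec _≟XY_ (proj₂ (φterm t)) u) p)

NonzeroCoeff : Poly → List XY → Set
NonzeroCoeff p u = Σ' ℕ (λ k → coeff p u k ≡ 0 → ⊥')
  where
  open import Data.Product using () renaming (Σ to Σ')
  open import Data.Empty using () renaming (⊥ to ⊥')

fib : ℕ → ℕ
fib zero = 0
fib (suc zero) = 1
fib (suc (suc n)) = fib (suc n) + fib n

-- Give x weight 2 and y weight 1.  Every term of Dⁿ(x₀) is a word x₀ r in which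
-- r has weight n: x₀ stays in front because it has the least key, and D raises the weight
-- by one since R replaces a letter of weight w by one of weight w + 1.  Conversely, every
-- word v of weight n appears, as the image of x₀ r for the canonical sorted word r built
-- by reading v backwards: y is produced by applying R at x₀ (x₀ ↦ x₀ y₁) and x by then
-- applying R at the new y₁ (y₁ ↦ x₁).  So the words of φⁿᶜ(Dⁿ(x₀)) are x v with v a
-- composition of n into parts 1 and 2, and there are F_{n+1} of those.
module Submission where

open import Defs
open import Data.Nat using (ℕ; zero; suc; _+_; _≤_; _≥_; _≤ᵇ_; z≤n; s≤s)
open import Data.Nat.Properties using (≤-trans; ≤⇒≤ᵇ; *-suc; +-suc; suc-injective)
open import Data.Nat.ListAction using (sum)
open import Data.Nat.ListAction.Properties using (sum-++; sum-↭)
open import Data.Bool using (true; false)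
open import Data.List using (List; []; _∷_; _++_; map; length)
open import Data.List.Properties using (map-++; length-++; length-map; ++-assoc; ∷-injectiveʳ)
open import Data.List.Membership.Propositional using (_∈_; find; lose)
open import Data.List.Membership.Propositional.Properties
  using (∈-map⁺; ∈-map⁻; ∈-++⁺ˡ; ∈-++⁺ʳ; ∈-++⁻; ∈-concatMap⁺; ∈-concatMap⁻; ∈-filter⁺; ∈-filter⁻)
open import Data.List.Relation.Unary.Any using (here; there)
open import Data.List.Relation.Unary.AllPairs using ([]; _∷_)
open import Data.List.Relation.Unary.All using ([])
open import Data.List.Relation.Unary.Unique.Propositional using (Unique)
open import Data.List.Relation.Unary.Unique.Propositional.Properties using (++⁺)
  renaming (map⁺ to Unique-map⁺)
open import Data.List.Relation.Binary.Permutation.Propositional using (_↭_; refl; prep; swap; trans)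
open import Data.List.Relation.Binary.Permutation.Propositional.Properties using ()
  renaming (map⁺ to ↭-map⁺)
open import Data.Product using (Σ; ∃; _×_; _,_; proj₁; proj₂)
open import Data.Sum using (inj₁; inj₂)
open import Data.Empty using (⊥; ⊥-elim)
open import Data.Unit using (⊤; tt)
open import Function.Bundles using (_⇔_; mk⇔; module Equivalence)
open import Relation.Binary.PropositionalEquality
  using (_≡_; refl; cong; cong₂; subst; module ≡-Reasoning)
  renaming (trans to ≡-trans)

xyWeight : XY → ℕ
xyWeight x = 2
xyWeight y = 1

weight : List XY → ℕ
weight v = sum (map xyWeight v)

weight-++ : ∀ u v → weight (u ++ v) ≡ weight u + weight v
weight-++ u v = ≡-trans (cong sum (map-++ xyWeight u v)) (sum-++ (map xyWeight u) (map xyWeight v))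

weight-↭ : ∀ {u v} → u ↭ v → weight u ≡ weight v
weight-↭ p = sum-↭ (↭-map⁺ xyWeight p)

φword : Word → List XY
φword = map φletter

φword-↑ : ∀ w → φword (↑ w) ≡ φword w
φword-↑ [] = refl
φword-↑ (xₗ _ ∷ w) = cong (x ∷_) (φword-↑ w)
φword-↑ (yₗ _ ∷ w) = cong (y ∷_) (φword-↑ w)

insertAIO-↭ : ∀ a w → insertAIO a w ↭ a ∷ w
insertAIO-↭ a [] = refl
insertAIO-↭ a (b ∷ w) with key a ≤ᵇ key b
... | true = refl
... | false = trans (prep b (insertAIO-↭ a w)) (swap b a refl)

AIO-↭ : ∀ w → AIO w ↭ w
AIO-↭ [] = refl
AIO-↭ (a ∷ w) = trans (insertAIO-↭ a (AIO w)) (prep a (AIO-↭ w))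

weightφ : Word → ℕ
weightφ w = weight (φword w)

weightφ-++ : ∀ u v → weightφ (u ++ v) ≡ weightφ u + weightφ v
weightφ-++ u v = ≡-trans (cong weight (map-++ φletter u v)) (weight-++ (φword u) (φword v))

weightφ-AIO : ∀ w → weightφ (AIO w) ≡ weightφ w
weightφ-AIO w = weight-↭ (↭-map⁺ φletter (AIO-↭ w))

weightφ-R : ∀ a → weightφ (proj₂ (R a)) ≡ suc (xyWeight (φletter a))
weightφ-R (xₗ _) = refl
weightφ-R (yₗ _) = refl

weightφ-Dterm-aux : ∀ {e pre suf t} → t ∈ Dterm-aux e pre suf →
  weightφ (proj₂ t) ≡ suc (weightφ (pre ++ suf))
weightφ-Dterm-aux {pre = pre} {a ∷ s} (here refl) = begin
  weightφ (AIO (pre ++ proj₂ (R a) ++ ↑ s))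
    ≡⟨ weightφ-AIO (pre ++ proj₂ (R a) ++ ↑ s) ⟩
  weightφ (pre ++ proj₂ (R a) ++ ↑ s)
    ≡⟨ weightφ-++ pre _ ⟩
  weightφ pre + weightφ (proj₂ (R a) ++ ↑ s)
    ≡⟨ cong (weightφ pre +_) (weightφ-++ (proj₂ (R a)) (↑ s)) ⟩
  weightφ pre + (weightφ (proj₂ (R a)) + weightφ (↑ s))
    ≡⟨ cong (λ k → weightφ pre + (k + weightφ (↑ s))) (weightφ-R a) ⟩
  weightφ pre + (suc (xyWeight (φletter a)) + weightφ (↑ s))
    ≡⟨ cong (λ v → weightφ pre + (suc (xyWeight (φletter a)) + weight v)) (φword-↑ s) ⟩
  weightφ pre + suc (weightφ (a ∷ s))
    ≡⟨ +-suc (weightφ pre) _ ⟩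
  suc (weightφ pre + weightφ (a ∷ s))
    ≡⟨ cong suc (weightφ-++ pre (a ∷ s)) ⟨
  suc (weightφ (pre ++ a ∷ s)) ∎
  where open ≡-Reasoning
weightφ-Dterm-aux {pre = pre} {a ∷ s} (there t∈) =
  ≡-trans (weightφ-Dterm-aux t∈) (cong (λ w → suc (weightφ w)) (++-assoc pre (a ∷ []) s))

weightφ-Dterm : ∀ {e w t} → t ∈ Dterm (e , w) → weightφ (proj₂ t) ≡ suc (weightφ w)
weightφ-Dterm = weightφ-Dterm-aux {pre = []}

-- x₀ has key 0, the least one.
AIO-x₀∷ : ∀ w → AIO (xₗ 0 ∷ w) ≡ xₗ 0 ∷ AIO w
AIO-x₀∷ w with AIO w
... | [] = refl
... | _ ∷ _ = refl

Dterm-aux-x₀∷ : ∀ {e pre suf t} → t ∈ Dterm-aux e (xₗ 0 ∷ pre) suf → ∃ λ r → proj₂ t ≡ xₗ 0 ∷ r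
Dterm-aux-x₀∷ {pre = pre} {a ∷ s} (here refl) = _ , AIO-x₀∷ (pre ++ proj₂ (R a) ++ ↑ s)
Dterm-aux-x₀∷ {suf = _ ∷ _} (there t∈) = Dterm-aux-x₀∷ t∈

Dterm-x₀∷ : ∀ {e r t} → t ∈ Dterm (e , xₗ 0 ∷ r) → ∃ λ r′ → proj₂ t ≡ xₗ 0 ∷ r′
Dterm-x₀∷ {r = r} (here refl) = _ , AIO-x₀∷ (yₗ 1 ∷ ↑ r)
Dterm-x₀∷ (there t∈) = Dterm-aux-x₀∷ {pre = []} t∈

terms-of-Dⁿx₀ : ∀ n {e w} → (e , w) ∈ iterate n D x₀ → ∃ λ r → w ≡ xₗ 0 ∷ r × weightφ r ≡ n
terms-of-Dⁿx₀ zero (here refl) = [] , refl , refl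
terms-of-Dⁿx₀ (suc n) t∈ with find (∈-concatMap⁻ Dterm {xs = iterate n D x₀} t∈)
... | (e , w) , s∈ , t∈Dterm with terms-of-Dⁿx₀ n s∈
... | r , refl , refl with Dterm-x₀∷ t∈Dterm
... | r′ , refl = r′ , refl , suc-injective (suc-injective (weightφ-Dterm t∈Dterm))

∈-D : ∀ {P s t} → s ∈ P → t ∈ Dterm s → t ∈ D P
∈-D {P} s∈ t∈ = ∈-concatMap⁺ Dterm {xs = P} (lose s∈ t∈)

SortedFrom : ℕ → Word → Set
SortedFrom k [] = ⊤
SortedFrom k (a ∷ w) = k ≤ key a × SortedFrom (key a) w

SortedFrom-weaken : ∀ {j k} w → j ≤ k → SortedFrom k w → SortedFrom j w
SortedFrom-weaken [] _ _ = tt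
SortedFrom-weaken (a ∷ w) j≤k (k≤a , sorted) = ≤-trans j≤k k≤a , sorted

key-shiftL : ∀ a → key (shiftL a) ≡ suc (suc (key a))
key-shiftL (xₗ i) = *-suc 2 i
key-shiftL (yₗ i) = cong suc (*-suc 2 i)

SortedFrom-↑ : ∀ {k} w → SortedFrom k w → SortedFrom (suc (suc k)) (↑ w)
SortedFrom-↑ [] _ = tt
SortedFrom-↑ (a ∷ w) (k≤a , sorted) rewrite key-shiftL a = s≤s (s≤s k≤a) , SortedFrom-↑ w sorted

AIO-sorted : ∀ {k} w → SortedFrom k w → AIO w ≡ w
AIO-sorted [] _ = refl
AIO-sorted (a ∷ []) _ = refl
AIO-sorted (a ∷ b ∷ w) (_ , sorted) rewrite AIO-sorted (b ∷ w) sorted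
  with key a ≤ᵇ key b | ≤⇒≤ᵇ (proj₁ sorted)
... | true | _ = refl

D-expands-x₀ : ∀ {P e w} → SortedFrom 2 w → (e , xₗ 0 ∷ w) ∈ P →
  (e + 0 , xₗ 0 ∷ yₗ 1 ∷ ↑ w) ∈ D P
D-expands-x₀ {e = e} {w} sorted s∈ = ∈-D s∈ (subst (λ v → (e + 0 , v) ∈ Dterm (e , xₗ 0 ∷ w))
  (AIO-sorted (xₗ 0 ∷ yₗ 1 ∷ ↑ w) sorted′) (here refl))
  where
  sorted′ : SortedFrom 0 (xₗ 0 ∷ yₗ 1 ∷ ↑ w)
  sorted′ = z≤n , z≤n , SortedFrom-weaken (↑ w) (s≤s (s≤s (s≤s z≤n))) (SortedFrom-↑ w sorted)

D-expands-y₁ : ∀ {P e w} → SortedFrom 2 w → (e , xₗ 0 ∷ yₗ 1 ∷ ↑ w) ∈ P →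
  (e + 1 , xₗ 0 ∷ xₗ 1 ∷ ↑ (↑ w)) ∈ D P
D-expands-y₁ {e = e} {w} sorted s∈ = ∈-D s∈ (subst (λ v → (e + 1 , v) ∈ Dterm (e , xₗ 0 ∷ yₗ 1 ∷ ↑ w))
  (AIO-sorted (xₗ 0 ∷ xₗ 1 ∷ ↑ (↑ w)) sorted′) (there (here refl)))
  where
  sorted′ : SortedFrom 0 (xₗ 0 ∷ xₗ 1 ∷ ↑ (↑ w))
  sorted′ = z≤n , z≤n , SortedFrom-weaken (↑ (↑ w)) (s≤s (s≤s z≤n)) (SortedFrom-↑ (↑ w) (SortedFrom-↑ w sorted))

canonical : List XY → Word
canonical [] = []
canonical (y ∷ v) = yₗ 1 ∷ ↑ (canonical v)
canonical (x ∷ v) = xₗ 1 ∷ ↑ (↑ (canonical v))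

φword-canonical : ∀ v → φword (canonical v) ≡ v
φword-canonical [] = refl
φword-canonical (y ∷ v) = cong (y ∷_) (≡-trans (φword-↑ (canonical v)) (φword-canonical v))
φword-canonical (x ∷ v) = cong (x ∷_)
  (≡-trans (φword-↑ (↑ (canonical v))) (≡-trans (φword-↑ (canonical v)) (φword-canonical v)))

canonical-sorted : ∀ v → SortedFrom 2 (canonical v)
canonical-sorted [] = tt
canonical-sorted (y ∷ v) = s≤s (s≤s z≤n) ,
  SortedFrom-weaken (↑ (canonical v)) (s≤s (s≤s (s≤s z≤n))) (SortedFrom-↑ (canonical v) (canonical-sorted v))
canonical-sorted (x ∷ v) = s≤s (s≤s z≤n) ,
  SortedFrom-weaken (↑ (↑ (canonical v))) (s≤s (s≤s z≤n))
    (SortedFrom-↑ (↑ (canonical v)) (SortedFrom-↑ (canonical v) (canonical-sorted v)))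

canonical-∈-Dⁿx₀ : ∀ v → ∃ λ e → (e , xₗ 0 ∷ canonical v) ∈ iterate (weight v) D x₀
canonical-∈-Dⁿx₀ [] = 0 , here refl
canonical-∈-Dⁿx₀ (y ∷ v) with canonical-∈-Dⁿx₀ v
... | _ , t∈ = _ , D-expands-x₀ (canonical-sorted v) t∈
canonical-∈-Dⁿx₀ (x ∷ v) with canonical-∈-Dⁿx₀ v
... | _ , t∈ = _ , D-expands-y₁ (canonical-sorted v) (D-expands-x₀ (canonical-sorted v) t∈)

compositions : ℕ → List (List XY)
compositions zero = [] ∷ []
compositions (suc zero) = (y ∷ []) ∷ []
compositions (suc (suc n)) = map (y ∷_) (compositions (suc n)) ++ map (x ∷_) (compositions n)

length-compositions : ∀ n → length (compositions n) ≡ fib (suc n)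
length-compositions zero = refl
length-compositions (suc zero) = refl
length-compositions (suc (suc n)) = ≡-trans (length-++ (map (y ∷_) (compositions (suc n))))
  (cong₂ _+_ (≡-trans (length-map _ (compositions (suc n))) (length-compositions (suc n)))
             (≡-trans (length-map _ (compositions n)) (length-compositions n)))

compositions-unique : ∀ n → Unique (compositions n)
compositions-unique zero = [] ∷ []
compositions-unique (suc zero) = [] ∷ []
compositions-unique (suc (suc n)) =
  ++⁺ (Unique-map⁺ ∷-injectiveʳ (compositions-unique (suc n)))
      (Unique-map⁺ ∷-injectiveʳ (compositions-unique n)) disjoint
  where
  disjoint : ∀ {v} → v ∈ map (y ∷_) (compositions (suc n)) × v ∈ map (x ∷_) (compositions n) → ⊥
  disjoint (p , q) with ∈-map⁻ (y ∷_) p | ∈-map⁻ (x ∷_) q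
  ... | _ , _ , refl | _ , _ , ()

weight-∈-compositions : ∀ n {v} → v ∈ compositions n → weight v ≡ n
weight-∈-compositions zero (here refl) = refl
weight-∈-compositions (suc zero) (here refl) = refl
weight-∈-compositions (suc (suc n)) v∈ with ∈-++⁻ (map (y ∷_) (compositions (suc n))) v∈
... | inj₁ v∈y with ∈-map⁻ (y ∷_) v∈y
...   | _ , u∈ , refl = cong suc (weight-∈-compositions (suc n) u∈)
weight-∈-compositions (suc (suc n)) v∈ | inj₂ v∈x with ∈-map⁻ (x ∷_) v∈x
...   | _ , u∈ , refl = cong (λ k → suc (suc k)) (weight-∈-compositions n u∈)

y∷-∈-compositions : ∀ n {v} → v ∈ compositions n → y ∷ v ∈ compositions (suc n)
y∷-∈-compositions zero (here refl) = here refl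
y∷-∈-compositions (suc n) v∈ = ∈-++⁺ˡ (∈-map⁺ (y ∷_) v∈)

∈-compositions-weight : ∀ v → v ∈ compositions (weight v)
∈-compositions-weight [] = here refl
∈-compositions-weight (y ∷ v) = y∷-∈-compositions (weight v) (∈-compositions-weight v)
∈-compositions-weight (x ∷ v) =
  ∈-++⁺ʳ (map (y ∷_) (compositions (suc (weight v)))) (∈-map⁺ (x ∷_) (∈-compositions-weight v))

NonzeroCoeff⇔∃term : ∀ p u → NonzeroCoeff p u ⇔ (∃ λ t → t ∈ p × φword (proj₂ t) ≡ u)
NonzeroCoeff⇔∃term p u = mk⇔ to from
  where
  member : ∀ {A : Set} (l : List A) → (length l ≡ 0 → ⊥) → ∃ λ a → a ∈ l
  member [] length≢0 = ⊥-elim (length≢0 refl)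
  member (a ∷ _) _ = a , here refl

  ∈⇒length≢0 : ∀ {A : Set} {a : A} {l} → a ∈ l → length l ≡ 0 → ⊥
  ∈⇒length≢0 {l = _ ∷ _} _ ()

  to : NonzeroCoeff p u → ∃ λ t → t ∈ p × φword (proj₂ t) ≡ u
  to (_ , coeff≢0) with member _ coeff≢0
  ... | t , t∈ with ∈-filter⁻ _ {xs = p} t∈
  ...   | t∈p , (_ , φt≡u) = t , t∈p , φt≡u

  from : (∃ λ t → t ∈ p × φword (proj₂ t) ≡ u) → NonzeroCoeff p u
  from (t , t∈p , φt≡u) = proj₁ t , ∈⇒length≢0 (∈-filter⁺ _ t∈p (refl , φt≡u))

proposition6p10 : (n : ℕ) → n ≥ 1 →
    Σ (List (List XY)) (λ ws →
      Unique ws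
      × ((u : List XY) → (u ∈ ws) ⇔ NonzeroCoeff (iterate n D x₀) u)
      × length ws ≡ fib (suc n))
proposition6p10 n _ =
  map (x ∷_) (compositions n) ,
  Unique-map⁺ ∷-injectiveʳ (compositions-unique n) ,
  (λ u → mk⇔ (attained u) (only-attained u)) ,
  ≡-trans (length-map _ (compositions n)) (length-compositions n)
  where
  attained : ∀ u → u ∈ map (x ∷_) (compositions n) → NonzeroCoeff (iterate n D x₀) u
  attained u u∈ with ∈-map⁻ (x ∷_) u∈
  ... | v , v∈ , refl with weight-∈-compositions n v∈
  ... | refl with canonical-∈-Dⁿx₀ v
  ... | _ , t∈ = Equivalence.from (NonzeroCoeff⇔∃term _ _)
                   (_ , t∈ , cong (x ∷_) (φword-canonical v))
  only-attained : ∀ u → NonzeroCoeff (iterate n D x₀) u → u ∈ map (x ∷_) (compositions n)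
  only-attained u nz with Equivalence.to (NonzeroCoeff⇔∃term (iterate n D x₀) u) nz
  ... | (_ , w) , t∈ , refl with terms-of-Dⁿx₀ n t∈
  ... | r , refl , refl = ∈-map⁺ (x ∷_) (∈-compositions-weight (φword r))
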